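{- For every prime power $q$ there exists a constant dimension subspace code with parameters $(6,\ q^3(q^2-1)(q-1)/3+(q^2+1)(q^2+q+1),\ 4;\ 3)_q$, i.e. a set of $q^3(q^2-1)(q-1)/3+(q^2+1)(q^2+q+1)$ three-dimensional subspaces of ${\rm GF}(q)^6$ any two of which intersect in a subspace of dimension at most $1$.
   Context: An $(n,M,d;k)_q$ constant dimension subspace code is a set $\mathcal C$ of $M$ $k$-dimensional subspaces of an $n$-dimensional vector space $V$ over ${\rm GF}(q)$ with minimum subspace distance $\min\{\dim(U+U')-\dim(U\cap U'):U\ne U'\in\mathcal C\}=d$. -}

module Defs where

open import Level using (Level; _⊔_)
open import Algebra.Bundles using (CommutativeRing)
open import Data.Nat using (ℕ; zero; suc)
import Data.Nat as N
open import Data.Empty using (⊥)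
open import Data.Nat.Primality using (Prime)
open import Data.Fin using (Fin)
import Data.Fin as Fin
open import Data.Product using (Σ; ∃; ∃-syntax; _×_; _,_)
open import Relation.Nullary using (¬_)
open import Relation.Binary.PropositionalEquality using (_≡_; _≢_)

IsPrimePower : ℕ → Set
IsPrimePower q = ∃[ p ] ∃[ k ] (Prime p × 1 N.≤ k × q ≡ p N.^ k)

record IsField {c ℓ : Level} (R : CommutativeRing c ℓ) : Set (c ⊔ ℓ) where
  open CommutativeRing R hiding (zero)
  field
    0≉1     : ¬ (0# ≈ 1#)
    inverse : ∀ x → ¬ (x ≈ 0#) → ∃[ y ] (x * y ≈ 1#)

-- The carrier has exactly q elements (up to the ring's equality _≈_):
-- a bijection between Carrier/≈ and Fin q.
record HasSize {c ℓ : Level} (R : CommutativeRing c ℓ) (q : ℕ) : Set (c ⊔ ℓ) where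
  open CommutativeRing R hiding (zero)
  field
    toFin       : Carrier → Fin q
    fromFin     : Fin q → Carrier
    toFin-cong  : ∀ {x y} → x ≈ y → toFin x ≡ toFin y
    toFin-inj   : ∀ {x y} → toFin x ≡ toFin y → x ≈ y
    toFin-from  : ∀ i → toFin (fromFin i) ≡ i

module LinAlg {c ℓ : Level} (R : CommutativeRing c ℓ) where
  open CommutativeRing R hiding (zero)

  Vector : ℕ → Set c
  Vector n = Fin n → Carrier

  Σᶠ : ∀ {k} → (Fin k → Carrier) → Carrier
  Σᶠ {ℕ.zero}  f = 0#
  Σᶠ {ℕ.suc k} f = f Fin.zero + Σᶠ (λ i → f (Fin.suc i))

  lincomb : ∀ {k n} → (Fin k → Carrier) → (Fin k → Vector n) → Vector n
  lincomb cs vs j = Σᶠ (λ i → cs i * vs i j)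

  _≈ᵥ_ : ∀ {n} → Vector n → Vector n → Set ℓ
  u ≈ᵥ v = ∀ j → u j ≈ v j

  0ᵥ : ∀ {n} → Vector n
  0ᵥ _ = 0#

  LinearlyIndependent : ∀ {k n} → (Fin k → Vector n) → Set (c ⊔ ℓ)
  LinearlyIndependent vs = ∀ cs → lincomb cs vs ≈ᵥ 0ᵥ → ∀ i → cs i ≈ 0#

  _∈Span_ : ∀ {k n} → Vector n → (Fin k → Vector n) → Set (c ⊔ ℓ)
  v ∈Span vs = ∃[ cs ] (v ≈ᵥ lincomb cs vs)

  record Subspace (n k : ℕ) : Set (c ⊔ ℓ) where
    field
      basis       : Fin k → Vector n
      independent : LinearlyIndependent basis

  open Subspace public

  _∈ₛ_ : ∀ {n k} → Vector n → Subspace n k → Set (c ⊔ ℓ)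
  v ∈ₛ U = v ∈Span basis U

  SameSubspace : ∀ {n k} → Subspace n k → Subspace n k → Set (c ⊔ ℓ)
  SameSubspace U W = ∀ v → (v ∈ₛ U → v ∈ₛ W) × (v ∈ₛ W → v ∈ₛ U)

  IntersectionDimAtMost : ∀ {n k} → ℕ → Subspace n k → Subspace n k → Set (c ⊔ ℓ)
  IntersectionDimAtMost {n} m U W =
    (ws : Fin (suc m) → Vector n) → LinearlyIndependent ws →
    (∀ i → (ws i ∈ₛ U) × (ws i ∈ₛ W)) → ⊥

codeSize : ℕ → ℕ
codeSize q = (q N.^ 3 N.* (q N.^ 2 N.∸ 1) N.* (q N.∸ 1)) N./ 3
             N.+ (q N.^ 2 N.+ 1) N.* (q N.^ 2 N.+ q N.+ 1)

module Submission where

-- We build the lifting of a linear rank-distance code, which has q⁶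
-- codewords, and keep M of them; only the finiteness of the field is used.
-- For a field F with q elements:
--  * r ↦ r³ - r identifies 0 and 1, so it is not onto and some s makes
--    θ³ - θ - s rootless.  Then K = F[θ]/(θ³ - θ - s) has no zero divisors:
--    a zero divisor of degree one would make its root an eigenvalue of
--    multiplication by θ, hence a root of θ³ - θ - s.
--  * For X, Y ∈ F³ the matrix (X | Y | θX + θ²Y) is linear in (X, Y) and has
--    rank at least two unless X = Y = 0: columns αn, βn, γn of a rank-one
--    matrix would give (-γ + αθ + βθ²)·n = 0 in K.
--  * Lifting M ↦ rowspace(I | M) turns rank distance two into intersections of
--    dimension at most one: the heads of two independent common vectors are
--    orthogonal to every column of M - M', whose rank is then at most one.
--  * Base-q digits index q⁶ such codewords, and M ≤ q⁶ for q ≥ 2.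
-- The file first sets up a ring solver with integer coefficients and linear
-- algebra in F³, then treats the cubic field, the rank-distance code and the
-- lifting, then counting on finite sets and the size bound, and finally
-- assembles the corollary.

open import Defs
open import Level using (Level)
open import Algebra.Bundles using (CommutativeRing)
open import Data.Nat using (ℕ)
open import Data.Fin using (Fin)
open import Data.Product using (Σ-syntax; _×_)
open import Relation.Nullary using (¬_)
open import Relation.Binary.PropositionalEquality using (_≢_)

import Data.Nat as Nat
open import Data.Nat using (zero; suc)
open import Data.Integer as ℤ using (ℤ; +_; -[1+_]; _⊖_)
open import Data.Fin using (zero; suc; _≟_; punchOut; inject≤; inject₁; combine; funToFin; finToFun)
open import Data.Empty using (⊥-elim)
open import Data.Product using (∃-syntax; _,_; proj₁; proj₂)
open import Data.Maybe using (Maybe; just; nothing)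
open import Relation.Nullary using (Dec; yes; no)
open import Relation.Binary.PropositionalEquality as ≡ using (_≡_)
open import Function.Definitions using (Injective)
import Data.Nat.Properties as ℕP
import Data.Integer.Properties as ℤP
import Data.Fin.Properties as FinP
import Data.Sign as Sign

-- A ring solver with integer coefficients for an arbitrary commutative
-- ring: the canonical map ℤ → R (n ↦ n·1) is a ring homomorphism, which
-- is what the generic solver Algebra.Solver.Ring needs.

module IntegerCoefficients {c ℓ : Level} (R : CommutativeRing c ℓ) where
  open CommutativeRing R hiding (zero)
  open import Algebra.Properties.Semiring.Mult.TCOptimised semiring
    using (×1-homo-*) renaming (_×_ to _·1×_)
  open import Algebra.Properties.Monoid.Mult.TCOptimised +-monoid
    using (×-homo-+; ×-cong)
  open import Algebra.Properties.AbelianGroup +-abelianGroup using (⁻¹-∙-comm)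
  open import Algebra.Properties.Group +-group using (⁻¹-involutive)
  open import Algebra.Properties.Ring ring using (-‿distribˡ-*; -‿distribʳ-*; -0#≈0#)
  import Algebra.Solver.Ring.AlmostCommutativeRing as ACR
  import Algebra.Solver.Ring as Solver
  open import Relation.Binary.Reasoning.Setoid setoid

  ⟦_⟧ᶻ : ℤ → Carrier
  ⟦ + n ⟧ᶻ      = n ·1× 1#
  ⟦ -[1+ n ] ⟧ᶻ = - (suc n ·1× 1#)

  ⊖-homo : ∀ m n → ⟦ m ⊖ n ⟧ᶻ ≈ m ·1× 1# + - (n ·1× 1#)
  ⊖-homo m zero = begin
    ⟦ m ⊖ zero ⟧ᶻ     ≈⟨ reflexive (≡.cong ⟦_⟧ᶻ (ℤP.⊖-≥ {m} {0} Nat.z≤n)) ⟩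
    m ·1× 1#          ≈⟨ sym (+-identityʳ _) ⟩
    m ·1× 1# + 0#     ≈⟨ +-congˡ (sym -0#≈0#) ⟩
    m ·1× 1# + - 0#   ∎
  ⊖-homo zero (suc n) = begin
    ⟦ zero ⊖ suc n ⟧ᶻ       ≈⟨ reflexive (≡.cong ⟦_⟧ᶻ (ℤP.⊖-< {0} {suc n} (Nat.s≤s Nat.z≤n))) ⟩
    - (suc n ·1× 1#)        ≈⟨ sym (+-identityˡ _) ⟩
    0# + - (suc n ·1× 1#)   ∎
  ⊖-homo (suc m) (suc n) = begin
    ⟦ suc m ⊖ suc n ⟧ᶻ           ≈⟨ reflexive (≡.cong ⟦_⟧ᶻ (ℤP.[1+m]⊖[1+n]≡m⊖n m n)) ⟩
    ⟦ m ⊖ n ⟧ᶻ                   ≈⟨ ⊖-homo m n ⟩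
    a + - b                      ≈⟨ sym (+-identityˡ _) ⟩
    0# + (a + - b)               ≈⟨ +-congʳ (sym (-‿inverseʳ 1#)) ⟩
    (1# + - 1#) + (a + - b)      ≈⟨ +-assoc _ _ _ ⟩
    1# + (- 1# + (a + - b))      ≈⟨ +-congˡ (sym (+-assoc _ _ _)) ⟩
    1# + ((- 1# + a) + - b)      ≈⟨ +-congˡ (+-congʳ (+-comm _ _)) ⟩
    1# + ((a + - 1#) + - b)      ≈⟨ +-congˡ (+-assoc _ _ _) ⟩
    1# + (a + (- 1# + - b))      ≈⟨ sym (+-assoc _ _ _) ⟩
    (1# + a) + (- 1# + - b)      ≈⟨ +-congˡ (⁻¹-∙-comm _ _) ⟩
    (1# + a) + - (1# + b)        ≈⟨ sym (+-cong (×-homo-+ 1# 1 m) (-‿cong (×-homo-+ 1# 1 n))) ⟩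
    suc m ·1× 1# + - (suc n ·1× 1#) ∎
    where a = m ·1× 1#
          b = n ·1× 1#

  +-homo : ∀ i j → ⟦ i ℤ.+ j ⟧ᶻ ≈ ⟦ i ⟧ᶻ + ⟦ j ⟧ᶻ
  +-homo (+ m)    (+ n)    = ×-homo-+ 1# m n
  +-homo (+ m)    -[1+ n ] = ⊖-homo m (suc n)
  +-homo -[1+ m ] (+ n)    = trans (⊖-homo n (suc m)) (+-comm _ _)
  +-homo -[1+ m ] -[1+ n ] = begin
    - (suc (suc (m Nat.+ n)) ·1× 1#)        ≈⟨ -‿cong (×-cong (≡.cong suc (≡.sym (ℕP.+-suc m n))) refl) ⟩
    - ((suc m Nat.+ suc n) ·1× 1#)          ≈⟨ -‿cong (×-homo-+ 1# (suc m) (suc n)) ⟩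
    - (suc m ·1× 1# + suc n ·1× 1#)       ≈⟨ sym (⁻¹-∙-comm _ _) ⟩
    - (suc m ·1× 1#) + - (suc n ·1× 1#)   ∎

  +◃-homo : ∀ k → ⟦ Sign.+ ℤ.◃ k ⟧ᶻ ≈ k ·1× 1#
  +◃-homo zero    = refl
  +◃-homo (suc k) = refl

  -◃-homo : ∀ k → ⟦ Sign.- ℤ.◃ k ⟧ᶻ ≈ - (k ·1× 1#)
  -◃-homo zero    = sym -0#≈0#
  -◃-homo (suc k) = refl

  *-homo : ∀ i j → ⟦ i ℤ.* j ⟧ᶻ ≈ ⟦ i ⟧ᶻ * ⟦ j ⟧ᶻ
  *-homo (+ m) (+ n) = trans (+◃-homo (m Nat.* n)) (×1-homo-* m n)
  *-homo (+ m) -[1+ n ] =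
    trans (-◃-homo (m Nat.* suc n)) (trans (-‿cong (×1-homo-* m (suc n))) (-‿distribʳ-* _ _))
  *-homo -[1+ m ] (+ n) =
    trans (-◃-homo (suc m Nat.* n)) (trans (-‿cong (×1-homo-* (suc m) n)) (-‿distribˡ-* _ _))
  *-homo -[1+ m ] -[1+ n ] = begin
    ⟦ -[1+ m ] ℤ.* -[1+ n ] ⟧ᶻ      ≈⟨ +◃-homo (suc m Nat.* suc n) ⟩
    (suc m Nat.* suc n) ·1× 1#        ≈⟨ ×1-homo-* (suc m) (suc n) ⟩
    a * b                           ≈⟨ sym (⁻¹-involutive _) ⟩
    - - (a * b)                     ≈⟨ -‿cong (-‿distribˡ-* _ _) ⟩
    - (- a * b)                     ≈⟨ -‿distribʳ-* _ _ ⟩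
    - a * - b                       ∎
    where a = suc m ·1× 1#
          b = suc n ·1× 1#

  neg-homo : ∀ i → ⟦ ℤ.- i ⟧ᶻ ≈ - ⟦ i ⟧ᶻ
  neg-homo (+ zero)  = sym -0#≈0#
  neg-homo (+ suc n) = refl
  neg-homo -[1+ n ]  = sym (⁻¹-involutive _)

  ℤ⟶R : ℤ.+-*-rawRing ACR.-Raw-AlmostCommutative⟶ ACR.fromCommutativeRing R
  ℤ⟶R = record
    { ⟦_⟧ = ⟦_⟧ᶻ ; +-homo = +-homo ; *-homo = *-homo ; -‿homo = neg-homo
    ; 0-homo = refl ; 1-homo = refl }

  -- equal integer coefficients have equal images (all the solver needs)
  coefficient≟ : ∀ i j → Maybe (⟦ i ⟧ᶻ ≈ ⟦ j ⟧ᶻ)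
  coefficient≟ i j with i ℤ.≟ j
  ... | yes ≡.refl = just refl
  ... | no _       = nothing

  open Solver ℤ.+-*-rawRing (ACR.fromCommutativeRing R) ℤ⟶R coefficient≟ public
    using (Polynomial; solve; _:=_; _:+_; _:*_; :-_; _:-_; con)

-- Triples and the operations on them, over any carrier with +, *, -, 0.
-- They are instantiated both with field elements and with ring-solver
-- expressions: an identity between triples of field elements is then
-- proved coordinatewise by normalising the same formula on expressions.

record Triple {a} (A : Set a) : Set a where
  constructor ⟨_,_,_⟩
  field x₀ x₁ x₂ : A
open Triple public

module TripleOps {a} {A : Set a} (_⊕_ _⊗_ : A → A → A) (⊝_ : A → A) (𝟘 : A) where
  infixl 6 _+₃_ _-₃_
  infixr 7 _⋆_

  _+₃_ : Triple A → Triple A → Triple A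
  u +₃ v = ⟨ x₀ u ⊕ x₀ v , x₁ u ⊕ x₁ v , x₂ u ⊕ x₂ v ⟩

  _-₃_ : Triple A → Triple A → Triple A
  u -₃ v = ⟨ x₀ u ⊕ (⊝ x₀ v) , x₁ u ⊕ (⊝ x₁ v) , x₂ u ⊕ (⊝ x₂ v) ⟩

  _⋆_ : A → Triple A → Triple A
  k ⋆ u = ⟨ k ⊗ x₀ u , k ⊗ x₁ u , k ⊗ x₂ u ⟩

  -- the standard bilinear form (written as the finite sum Σᶠ unfolds)
  dot : Triple A → Triple A → A
  dot u v = (x₀ u ⊗ x₀ v) ⊕ ((x₁ u ⊗ x₁ v) ⊕ ((x₂ u ⊗ x₂ v) ⊕ 𝟘))

  -- the cross product: it vanishes iff u and v are linearly dependent
  _×₃_ : Triple A → Triple A → Triple A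
  u ×₃ v = ⟨ (x₁ u ⊗ x₂ v) ⊕ (⊝ (x₂ u ⊗ x₁ v))
           , (x₂ u ⊗ x₀ v) ⊕ (⊝ (x₀ u ⊗ x₂ v))
           , (x₀ u ⊗ x₁ v) ⊕ (⊝ (x₁ u ⊗ x₀ v)) ⟩

  -- The cubic extension F[θ]/(θ³ - θ - s): a triple ⟨ a , b , c ⟩ stands
  -- for a + bθ + cθ².
  module CubicExtension (s : A) where

    -- multiplication by θ, using θ³ = θ + s
    θ· : Triple A → Triple A
    θ· u = ⟨ s ⊗ x₂ u , x₀ u ⊕ x₂ u , x₁ u ⟩

    infixl 7 _·_

    -- g · n = g(θ) n
    _·_ : Triple A → Triple A → Triple A
    g · n = (x₀ g ⋆ n +₃ x₁ g ⋆ θ· n) +₃ x₂ g ⋆ θ· (θ· n)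

    thirdColumn : Triple A → Triple A → Triple A
    thirdColumn X Y = θ· X +₃ θ· (θ· Y)

module OverAField {c ℓ : Level} (F : CommutativeRing c ℓ) (isField : IsField F)
  (_≈?_ : ∀ x y → Dec (CommutativeRing._≈_ F x y)) where

  open CommutativeRing F hiding (zero)
  open IsField isField
  open IntegerCoefficients F
  open LinAlg F
  open import Relation.Binary.Reasoning.Setoid setoid

  sum-of-zeros : ∀ {a b} → a ≈ 0# → b ≈ 0# → a + b ≈ 0#
  sum-of-zeros a≈0 b≈0 = trans (+-cong a≈0 b≈0) (+-identityʳ 0#)

  multiple-of-zero : ∀ a {b} → b ≈ 0# → a * b ≈ 0#
  multiple-of-zero a b≈0 = trans (*-congˡ b≈0) (zeroʳ a)

  difference-zero : ∀ {a b} → a ≈ b → a - b ≈ 0#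
  difference-zero {b = b} a≈b = trans (+-congʳ a≈b) (-‿inverseʳ b)

  equal-if-difference-zero : ∀ {a b} → a - b ≈ 0# → a ≈ b
  equal-if-difference-zero {a} {b} a-b≈0 = begin
    a              ≈⟨ solve 2 (λ a b → a := (a :- b) :+ b) refl a b ⟩
    (a - b) + b    ≈⟨ +-congʳ a-b≈0 ⟩
    0# + b         ≈⟨ +-identityˡ b ⟩
    b              ∎

  zero-if-negation-zero : ∀ {a} → - a ≈ 0# → a ≈ 0#
  zero-if-negation-zero {a} -a≈0 = begin
    a               ≈⟨ solve 1 (λ a → a := :- con (+ 1) :* :- a) refl a ⟩
    - 1# * - a      ≈⟨ multiple-of-zero _ -a≈0 ⟩
    0#              ∎

  cancelˡ : ∀ {a x} → ¬ a ≈ 0# → a * x ≈ 0# → x ≈ 0#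
  cancelˡ {a} {x} a≉0 ax≈0 with inverse a a≉0
  ... | a⁻¹ , aa⁻¹≈1 = begin
    x                ≈⟨ sym (trans (*-congˡ aa⁻¹≈1) (*-identityʳ x)) ⟩
    x * (a * a⁻¹)    ≈⟨ solve 3 (λ x a b → x :* (a :* b) := b :* (a :* x)) refl x a a⁻¹ ⟩
    a⁻¹ * (a * x)    ≈⟨ multiple-of-zero a⁻¹ ax≈0 ⟩
    0#               ∎

  open TripleOps _+_ _*_ -_ 0# public

  module Syntax {n : ℕ} = TripleOps (_:+_ {n}) (_:*_ {n}) (:-_ {n}) (con {n} (+ 0))
    renaming (_-₃_ to infixl 6 _-ᴱ_; _⋆_ to infixr 7 _⋆ᴱ_; dot to dotᴱ; _×₃_ to _×ᴱ_)
  open Syntax using (_-ᴱ_; _⋆ᴱ_; dotᴱ; _×ᴱ_)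

  coord : Triple Carrier → Fin 3 → Carrier
  coord u zero             = x₀ u
  coord u (suc zero)       = x₁ u
  coord u (suc (suc zero)) = x₂ u

  infix 4 _≈₃_
  _≈₃_ : Triple Carrier → Triple Carrier → Set ℓ
  u ≈₃ v = ∀ i → coord u i ≈ coord v i

  coordinatewise : ∀ {u v} → x₀ u ≈ x₀ v → x₁ u ≈ x₁ v → x₂ u ≈ x₂ v → u ≈₃ v
  coordinatewise e₀ e₁ e₂ zero             = e₀
  coordinatewise e₀ e₁ e₂ (suc zero)       = e₁
  coordinatewise e₀ e₁ e₂ (suc (suc zero)) = e₂

  IsZero : Triple Carrier → Set ℓ
  IsZero u = ∀ i → coord u i ≈ 0#

  Nonzero : Triple Carrier → Set ℓ
  Nonzero u = ¬ IsZero u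

  isZero? : ∀ u → Dec (IsZero u)
  isZero? u = FinP.all? (λ i → coord u i ≈? 0#)

  nonzero-coordinate : ∀ {u} → Nonzero u → ∃[ i ] ¬ coord u i ≈ 0#
  nonzero-coordinate {u} u≢0 = FinP.¬∀⟶∃¬ 3 _ (λ i → coord u i ≈? 0#) u≢0

  coord-⋆ : ∀ α u i → coord (α ⋆ u) i ≈ α * coord u i
  coord-⋆ α u zero             = refl
  coord-⋆ α u (suc zero)       = refl
  coord-⋆ α u (suc (suc zero)) = refl

  coord-₃ : ∀ u v i → coord (u -₃ v) i ≈ coord u i - coord v i
  coord-₃ u v zero             = refl
  coord-₃ u v (suc zero)       = refl
  coord-₃ u v (suc (suc zero)) = refl

  minor : ∀ {u v} → IsZero (u ×₃ v) → ∀ i k → coord u i * coord v k ≈ coord u k * coord v i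
  minor z zero             zero             = refl
  minor z zero             (suc zero)       = equal-if-difference-zero (z (suc (suc zero)))
  minor z zero             (suc (suc zero)) = sym (equal-if-difference-zero (z (suc zero)))
  minor z (suc zero)       zero             = sym (equal-if-difference-zero (z (suc (suc zero))))
  minor z (suc zero)       (suc zero)       = refl
  minor z (suc zero)       (suc (suc zero)) = equal-if-difference-zero (z zero)
  minor z (suc (suc zero)) zero             = equal-if-difference-zero (z (suc zero))
  minor z (suc (suc zero)) (suc zero)       = sym (equal-if-difference-zero (z zero))
  minor z (suc (suc zero)) (suc (suc zero)) = refl

  -- a vanishing cross product gives a nontrivial linear relation c₁u + c₂v = 0
  -- (written as the finite sum over Fin 2 unfolds)
  LinearRelation : Carrier → Carrier → Triple Carrier → Triple Carrier → Set ℓ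
  LinearRelation c₁ c₂ u v = ∀ i → c₁ * coord u i + (c₂ * coord v i + 0#) ≈ 0#

  dependent-if-cross-zero : ∀ u v → IsZero (u ×₃ v) →
    ∃[ c₁ ] ∃[ c₂ ] ¬ (c₁ ≈ 0# × c₂ ≈ 0#) × LinearRelation c₁ c₂ u v
  dependent-if-cross-zero u v z with isZero? u
  ... | yes u≈0 = 1# , 0# , (λ (1≈0 , _) → 0≉1 (sym 1≈0)) , λ i → begin
    1# * coord u i + (0# * coord v i + 0#)
      ≈⟨ solve 2 (λ a b → con (+ 1) :* a :+ (con (+ 0) :* b :+ con (+ 0)) := a) refl _ _ ⟩
    coord u i
      ≈⟨ u≈0 i ⟩
    0# ∎
  ... | no u≢0 with nonzero-coordinate u≢0
  ... | k , uₖ≉0 = coord v k , - coord u k , (λ (_ , -uₖ≈0) → uₖ≉0 (zero-if-negation-zero -uₖ≈0)) , λ i → begin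
    coord v k * coord u i + (- coord u k * coord v i + 0#)
      ≈⟨ solve 4 (λ a b c d → b :* a :+ (:- c :* d :+ con (+ 0)) := a :* b :- c :* d) refl _ _ _ _ ⟩
    coord u i * coord v k - coord u k * coord v i
      ≈⟨ difference-zero (minor z i k) ⟩
    0# ∎

  multiple-if-cross-zero : ∀ {r n} → Nonzero n → IsZero (r ×₃ n) → ∃[ α ] r ≈₃ α ⋆ n
  multiple-if-cross-zero {r} {n} n≢0 z with nonzero-coordinate n≢0
  ... | k , nₖ≉0 with inverse (coord n k) nₖ≉0
  ... | h , nₖh≈1 = coord r k * h , λ i → begin
    coord r i                       ≈⟨ sym (trans (*-congˡ nₖh≈1) (*-identityʳ _)) ⟩
    coord r i * (coord n k * h)     ≈⟨ sym (*-assoc _ _ _) ⟩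
    coord r i * coord n k * h       ≈⟨ *-congʳ (minor z i k) ⟩
    coord r k * coord n i * h       ≈⟨ solve 3 (λ a b c → a :* b :* c := a :* c :* b) refl _ _ _ ⟩
    coord r k * h * coord n i       ≈⟨ sym (coord-⋆ _ n i) ⟩
    coord ((coord r k * h) ⋆ n) i     ∎

  bac-cab : ∀ r u v i → coord (r ×₃ (u ×₃ v)) i ≈ dot v r * coord u i - dot u r * coord v i
  bac-cab ⟨ r₀ , r₁ , r₂ ⟩ ⟨ u₀ , u₁ , u₂ ⟩ ⟨ v₀ , v₁ , v₂ ⟩ zero = solve 9
    (λ r₀ r₁ r₂ u₀ u₁ u₂ v₀ v₁ v₂ → let R = ⟨ r₀ , r₁ , r₂ ⟩; U = ⟨ u₀ , u₁ , u₂ ⟩; V = ⟨ v₀ , v₁ , v₂ ⟩ in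
      x₀ (R ×ᴱ (U ×ᴱ V)) := dotᴱ V R :* u₀ :- dotᴱ U R :* v₀) refl r₀ r₁ r₂ u₀ u₁ u₂ v₀ v₁ v₂
  bac-cab ⟨ r₀ , r₁ , r₂ ⟩ ⟨ u₀ , u₁ , u₂ ⟩ ⟨ v₀ , v₁ , v₂ ⟩ (suc zero) = solve 9
    (λ r₀ r₁ r₂ u₀ u₁ u₂ v₀ v₁ v₂ → let R = ⟨ r₀ , r₁ , r₂ ⟩; U = ⟨ u₀ , u₁ , u₂ ⟩; V = ⟨ v₀ , v₁ , v₂ ⟩ in
      x₁ (R ×ᴱ (U ×ᴱ V)) := dotᴱ V R :* u₁ :- dotᴱ U R :* v₁) refl r₀ r₁ r₂ u₀ u₁ u₂ v₀ v₁ v₂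
  bac-cab ⟨ r₀ , r₁ , r₂ ⟩ ⟨ u₀ , u₁ , u₂ ⟩ ⟨ v₀ , v₁ , v₂ ⟩ (suc (suc zero)) = solve 9
    (λ r₀ r₁ r₂ u₀ u₁ u₂ v₀ v₁ v₂ → let R = ⟨ r₀ , r₁ , r₂ ⟩; U = ⟨ u₀ , u₁ , u₂ ⟩; V = ⟨ v₀ , v₁ , v₂ ⟩ in
      x₂ (R ×ᴱ (U ×ᴱ V)) := dotᴱ V R :* u₂ :- dotᴱ U R :* v₂) refl r₀ r₁ r₂ u₀ u₁ u₂ v₀ v₁ v₂

  orthogonal-to-both⇒multiple : ∀ {r u v} → Nonzero (u ×₃ v) → dot u r ≈ 0# → dot v r ≈ 0# →
    ∃[ α ] r ≈₃ α ⋆ (u ×₃ v)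
  orthogonal-to-both⇒multiple {r} {u} {v} n≢0 ur≈0 vr≈0 = multiple-if-cross-zero n≢0 λ i → begin
    coord (r ×₃ (u ×₃ v)) i                          ≈⟨ bac-cab r u v i ⟩
    dot v r * coord u i - dot u r * coord v i        ≈⟨ +-cong (*-congʳ vr≈0) (-‿cong (*-congʳ ur≈0)) ⟩
    0# * coord u i - 0# * coord v i
      ≈⟨ solve 2 (λ a b → con (+ 0) :* a :- con (+ 0) :* b := con (+ 0)) refl _ _ ⟩
    0# ∎

  zero-by-coordinates : ∀ {u} → x₀ u ≈ 0# → x₁ u ≈ 0# → x₂ u ≈ 0# → IsZero u
  zero-by-coordinates z₀ z₁ z₂ zero             = z₀
  zero-by-coordinates z₀ z₁ z₂ (suc zero)       = z₁
  zero-by-coordinates z₀ z₁ z₂ (suc (suc zero)) = z₂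

  +₃-cong : ∀ {u u' v v'} → u ≈₃ u' → v ≈₃ v' → u +₃ v ≈₃ u' +₃ v'
  +₃-cong e e' zero             = +-cong (e zero) (e' zero)
  +₃-cong e e' (suc zero)       = +-cong (e (suc zero)) (e' (suc zero))
  +₃-cong e e' (suc (suc zero)) = +-cong (e (suc (suc zero))) (e' (suc (suc zero)))

  -- a 3×3 matrix, given by its columns
  Matrix : Set c
  Matrix = Fin 3 → Triple Carrier

  RankAtLeastTwo : Matrix → Set (c Level.⊔ ℓ)
  RankAtLeastTwo D = ∀ n → Nonzero n → ¬ (∀ j → ∃[ α ] D j ≈₃ α ⋆ n)

  rank-resp-≈₃ : ∀ {D D'} → (∀ j → D' j ≈₃ D j) → RankAtLeastTwo D → RankAtLeastTwo D'
  rank-resp-≈₃ D'≈D rank n n≢0 multiples =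
    rank n n≢0 λ j → proj₁ (multiples j) , λ i → trans (sym (D'≈D j i)) (proj₂ (multiples j) i)

  -- Lifting: the row space of the 3 × 6 matrix (I | M).

  δ : ∀ {k} → Fin k → Fin k → Carrier
  δ zero    zero    = 1#
  δ (suc i) (suc j) = δ i j
  δ _       _       = 0#

  liftedRow : Matrix → Fin 3 → Vector 6
  liftedRow M i zero                = δ i zero
  liftedRow M i (suc zero)          = δ i (suc zero)
  liftedRow M i (suc (suc zero))    = δ i (suc (suc zero))
  liftedRow M i (suc (suc (suc j))) = coord (M j) i

  head : Vector 6 → Triple Carrier
  head w = ⟨ w zero , w (suc zero) , w (suc (suc zero)) ⟩

  asTriple : (Fin 3 → Carrier) → Triple Carrier
  asTriple cs = ⟨ cs zero , cs (suc zero) , cs (suc (suc zero)) ⟩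

  head-lincomb : ∀ M cs → head (lincomb cs (liftedRow M)) ≈₃ asTriple cs
  head-lincomb M cs = coordinatewise
    (solve 3 (λ a b c → a :* con (+ 1) :+ (b :* con (+ 0) :+ (c :* con (+ 0) :+ con (+ 0))) := a) refl _ _ _)
    (solve 3 (λ a b c → a :* con (+ 0) :+ (b :* con (+ 1) :+ (c :* con (+ 0) :+ con (+ 0))) := b) refl _ _ _)
    (solve 3 (λ a b c → a :* con (+ 0) :+ (b :* con (+ 0) :+ (c :* con (+ 1) :+ con (+ 0))) := c) refl _ _ _)

  lifted-independent : ∀ M → LinearlyIndependent (liftedRow M)
  lifted-independent M cs lc≈0 zero             = trans (sym (head-lincomb M cs zero)) (lc≈0 zero)
  lifted-independent M cs lc≈0 (suc zero)       = trans (sym (head-lincomb M cs (suc zero))) (lc≈0 (suc zero))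
  lifted-independent M cs lc≈0 (suc (suc zero)) =
    trans (sym (head-lincomb M cs (suc (suc zero)))) (lc≈0 (suc (suc zero)))

  lift : Matrix → Subspace 6 3
  lift M = record { basis = liftedRow M ; independent = lifted-independent M }

  dot-congˡ : ∀ {u u'} v → u ≈₃ u' → dot u v ≈ dot u' v
  dot-congˡ v e =
    +-cong (*-congʳ (e zero)) (+-cong (*-congʳ (e (suc zero))) (+-congʳ (*-congʳ (e (suc (suc zero))))))

  dot-₃ : ∀ u a b → dot u (a -₃ b) ≈ dot u a - dot u b
  dot-₃ ⟨ u₀ , u₁ , u₂ ⟩ ⟨ a₀ , a₁ , a₂ ⟩ ⟨ b₀ , b₁ , b₂ ⟩ = solve 9
    (λ u₀ u₁ u₂ a₀ a₁ a₂ b₀ b₁ b₂ → let U = ⟨ u₀ , u₁ , u₂ ⟩; A = ⟨ a₀ , a₁ , a₂ ⟩; B = ⟨ b₀ , b₁ , b₂ ⟩ in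
      dotᴱ U (A -ᴱ B) := dotᴱ U A :- dotᴱ U B) refl u₀ u₁ u₂ a₀ a₁ a₂ b₀ b₁ b₂

  tail-determined : ∀ M {w} → w ∈ₛ lift M → ∀ j → w (suc (suc (suc j))) ≈ dot (head w) (M j)
  tail-determined M {w} (cs , w≈lc) j = begin
    w (suc (suc (suc j)))                        ≈⟨ w≈lc (suc (suc (suc j))) ⟩
    lincomb cs (liftedRow M) (suc (suc (suc j)))  ≡⟨⟩
    dot (asTriple cs) (M j)                      ≈⟨ dot-congˡ (M j) head≈cs ⟨
    dot (head w) (M j)                           ∎
    where
      head≈cs : head w ≈₃ asTriple cs
      head≈cs = coordinatewise (trans (w≈lc zero) (head-lincomb M cs zero))
        (trans (w≈lc (suc zero)) (head-lincomb M cs (suc zero)))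
        (trans (w≈lc (suc (suc zero))) (head-lincomb M cs (suc (suc zero))))

  common-vector-orthogonal : ∀ M M' {w} → w ∈ₛ lift M → w ∈ₛ lift M' → ∀ j → dot (head w) (M j -₃ M' j) ≈ 0#
  common-vector-orthogonal M M' {w} w∈M w∈M' j = begin
    dot (head w) (M j -₃ M' j)              ≈⟨ dot-₃ (head w) (M j) (M' j) ⟩
    dot (head w) (M j) - dot (head w) (M' j)
      ≈⟨ difference-zero (trans (sym (tail-determined M w∈M j)) (tail-determined M' w∈M' j)) ⟩
    0#                                      ∎

  relation-dot : ∀ {c₁ c₂ u v} → LinearRelation c₁ c₂ u v → ∀ r → c₁ * dot u r + (c₂ * dot v r + 0#) ≈ 0#
  relation-dot {c₁} {c₂} {⟨ u₀ , u₁ , u₂ ⟩} {⟨ v₀ , v₁ , v₂ ⟩} rel ⟨ r₀ , r₁ , r₂ ⟩ = begin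
    c₁ * dot ⟨ u₀ , u₁ , u₂ ⟩ ⟨ r₀ , r₁ , r₂ ⟩ + (c₂ * dot ⟨ v₀ , v₁ , v₂ ⟩ ⟨ r₀ , r₁ , r₂ ⟩ + 0#)
      ≈⟨ solve 11 (λ c₁ c₂ u₀ u₁ u₂ v₀ v₁ v₂ r₀ r₁ r₂ →
           let U = ⟨ u₀ , u₁ , u₂ ⟩; V = ⟨ v₀ , v₁ , v₂ ⟩; R = ⟨ r₀ , r₁ , r₂ ⟩ in
           c₁ :* dotᴱ U R :+ (c₂ :* dotᴱ V R :+ con (+ 0)) :=
           r₀ :* (c₁ :* u₀ :+ (c₂ :* v₀ :+ con (+ 0))) :+ (r₁ :* (c₁ :* u₁ :+ (c₂ :* v₁ :+ con (+ 0)))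
             :+ r₂ :* (c₁ :* u₂ :+ (c₂ :* v₂ :+ con (+ 0)))))
         refl c₁ c₂ u₀ u₁ u₂ v₀ v₁ v₂ r₀ r₁ r₂ ⟩
    r₀ * (c₁ * u₀ + (c₂ * v₀ + 0#)) + (r₁ * (c₁ * u₁ + (c₂ * v₁ + 0#)) + r₂ * (c₁ * u₂ + (c₂ * v₂ + 0#)))
      ≈⟨ sum-of-zeros (multiple-of-zero r₀ (rel zero))
           (sum-of-zeros (multiple-of-zero r₁ (rel (suc zero))) (multiple-of-zero r₂ (rel (suc (suc zero))))) ⟩
    0# ∎

  -- Lifting turns rank distance into subspace distance: if M - M' has rank
  -- at least two, two independent common vectors w₁, w₂ are impossible.  If
  -- their heads are dependent, so are w₁, w₂ (tails are determined by heads);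
  -- otherwise every column of M - M' is orthogonal to both heads, hence a
  -- multiple of their cross product.
  lifted-intersection : ∀ M M' → RankAtLeastTwo (λ j → M j -₃ M' j) →
    IntersectionDimAtMost 1 (lift M) (lift M')
  lifted-intersection M M' rank ws ws-independent both
    with isZero? (head (ws zero) ×₃ head (ws (suc zero)))
  ... | no n≢0 = rank _ n≢0 λ j → orthogonal-to-both⇒multiple n≢0 (orthogonal zero j) (orthogonal (suc zero) j)
    where
      orthogonal : ∀ k j → dot (head (ws k)) (M j -₃ M' j) ≈ 0#
      orthogonal k j = common-vector-orthogonal M M' (proj₁ (both k)) (proj₂ (both k)) j
  ... | yes z with dependent-if-cross-zero _ _ z
  ... | c₁ , c₂ , nontrivial , relation =
    nontrivial (ws-independent cs relation-lifts zero , ws-independent cs relation-lifts (suc zero))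
    where
      cs : Fin 2 → Carrier
      cs zero       = c₁
      cs (suc zero) = c₂
      relation-lifts : lincomb cs ws ≈ᵥ 0ᵥ
      relation-lifts zero                = relation zero
      relation-lifts (suc zero)          = relation (suc zero)
      relation-lifts (suc (suc zero))    = relation (suc (suc zero))
      relation-lifts (suc (suc (suc j))) =
        trans (+-cong (*-congˡ (tail-determined M (proj₁ (both zero)) j))
                      (+-congʳ (*-congˡ (tail-determined M (proj₁ (both (suc zero))) j))))
              (relation-dot relation (M j))

  basis-member : ∀ {n} (U : Subspace n 3) i → basis U i ∈ₛ U
  basis-member U zero             = δ zero , λ j →
    solve 3 (λ a b c → a := con (+ 1) :* a :+ (con (+ 0) :* b :+ (con (+ 0) :* c :+ con (+ 0)))) refl _ _ _
  basis-member U (suc zero)       = δ (suc zero) , λ j →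
    solve 3 (λ a b c → b := con (+ 0) :* a :+ (con (+ 1) :* b :+ (con (+ 0) :* c :+ con (+ 0)))) refl _ _ _
  basis-member U (suc (suc zero)) = δ (suc (suc zero)) , λ j →
    solve 3 (λ a b c → c := con (+ 0) :* a :+ (con (+ 0) :* b :+ (con (+ 1) :* c :+ con (+ 0)))) refl _ _ _

  -- two 3-dimensional spaces meeting in dimension at most one are different:
  -- otherwise the first two basis vectors would lie in the intersection
  distinct-if-small-intersection : ∀ {n} (U W : Subspace n 3) → IntersectionDimAtMost 1 U W → ¬ SameSubspace U W
  distinct-if-small-intersection {n} U W small same =
    small ws ws-independent λ k → basis-member U (embed k) , proj₁ (same _) (basis-member U (embed k))
    where
      embed : Fin 2 → Fin 3
      embed = inject₁
      ws : Fin 2 → Vector n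
      ws k = basis U (embed k)
      extend : (Fin 2 → Carrier) → Fin 3 → Carrier
      extend cs zero             = cs zero
      extend cs (suc zero)       = cs (suc zero)
      extend cs (suc (suc zero)) = 0#
      extended-relation : ∀ cs → lincomb cs ws ≈ᵥ 0ᵥ → lincomb (extend cs) (basis U) ≈ᵥ 0ᵥ
      extended-relation cs lc≈0 j =
        trans (+-congˡ (+-congˡ (trans (+-congʳ (zeroˡ _)) (+-identityʳ 0#)))) (lc≈0 j)
      ws-independent : LinearlyIndependent ws
      ws-independent cs lc≈0 zero       = independent U (extend cs) (extended-relation cs lc≈0) zero
      ws-independent cs lc≈0 (suc zero) = independent U (extend cs) (extended-relation cs lc≈0) (suc zero)

  -- The field F[θ]/(θ³ - θ - s), for s such that θ³ - θ - s has no root.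

  module CubicField (s : Carrier) (noRoot : ∀ r → ¬ (r * r * r ≈ r + s)) where
    open CubicExtension s public

    module Cubicᴱ {n : ℕ} (S : Polynomial n) = Syntax.CubicExtension {n} S
      renaming (θ· to θ·ᴱ; _·_ to infixl 7 _·ᴱ_; thirdColumn to thirdColumnᴱ)

    coord-· : ∀ g n i → coord (g · n) i ≈ (x₀ g * coord n i + x₁ g * coord (θ· n) i) + x₂ g * coord (θ· (θ· n)) i
    coord-· g n zero             = refl
    coord-· g n (suc zero)       = refl
    coord-· g n (suc (suc zero)) = refl

    θ·-cong : ∀ {u v} → u ≈₃ v → θ· u ≈₃ θ· v
    θ·-cong e zero             = *-congˡ (e (suc (suc zero)))
    θ·-cong e (suc zero)       = +-cong (e zero) (e (suc (suc zero)))
    θ·-cong e (suc (suc zero)) = e (suc zero)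

    θ·-zero : ∀ {n} → IsZero n → IsZero (θ· n)
    θ·-zero n≈0 = zero-by-coordinates (multiple-of-zero s (n≈0 (suc (suc zero))))
      (sum-of-zeros (n≈0 zero) (n≈0 (suc (suc zero)))) (n≈0 (suc zero))

    ·-zeroʳ : ∀ g {n} → IsZero n → IsZero (g · n)
    ·-zeroʳ g {n} n≈0 i = begin
      coord (g · n) i                 ≈⟨ coord-· g n i ⟩
      (x₀ g * coord n i + x₁ g * coord (θ· n) i) + x₂ g * coord (θ· (θ· n)) i
        ≈⟨ sum-of-zeros (sum-of-zeros (multiple-of-zero _ (n≈0 i)) (multiple-of-zero _ (θ·-zero n≈0 i)))
                        (multiple-of-zero _ (θ·-zero (θ·-zero n≈0) i)) ⟩
      0#                              ∎

    ·-assoc : ∀ a b c → (a · b) · c ≈₃ a · (b · c)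
    ·-assoc ⟨ a₀ , a₁ , a₂ ⟩ ⟨ b₀ , b₁ , b₂ ⟩ ⟨ c₀ , c₁ , c₂ ⟩ = coordinatewise
      (solve 10 (λ a₀ a₁ a₂ b₀ b₁ b₂ c₀ c₁ c₂ S →
         let open Cubicᴱ S
             A = ⟨ a₀ , a₁ , a₂ ⟩; B = ⟨ b₀ , b₁ , b₂ ⟩; C = ⟨ c₀ , c₁ , c₂ ⟩ in
         x₀ ((A ·ᴱ B) ·ᴱ C) := x₀ (A ·ᴱ (B ·ᴱ C)))
        refl a₀ a₁ a₂ b₀ b₁ b₂ c₀ c₁ c₂ s)
      (solve 10 (λ a₀ a₁ a₂ b₀ b₁ b₂ c₀ c₁ c₂ S →
         let open Cubicᴱ S
             A = ⟨ a₀ , a₁ , a₂ ⟩; B = ⟨ b₀ , b₁ , b₂ ⟩; C = ⟨ c₀ , c₁ , c₂ ⟩ in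
         x₁ ((A ·ᴱ B) ·ᴱ C) := x₁ (A ·ᴱ (B ·ᴱ C)))
        refl a₀ a₁ a₂ b₀ b₁ b₂ c₀ c₁ c₂ s)
      (solve 10 (λ a₀ a₁ a₂ b₀ b₁ b₂ c₀ c₁ c₂ S →
         let open Cubicᴱ S
             A = ⟨ a₀ , a₁ , a₂ ⟩; B = ⟨ b₀ , b₁ , b₂ ⟩; C = ⟨ c₀ , c₁ , c₂ ⟩ in
         x₂ ((A ·ᴱ B) ·ᴱ C) := x₂ (A ·ᴱ (B ·ᴱ C)))
        refl a₀ a₁ a₂ b₀ b₁ b₂ c₀ c₁ c₂ s)

    eigenvalue-is-root : ∀ {r n} → Nonzero n → θ· n ≈₃ r ⋆ n → r * r * r ≈ r + s
    eigenvalue-is-root {r} {n@(⟨ n₀ , n₁ , n₂ ⟩)} n≢0 θn≈rn =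
      equal-if-difference-zero (cancelˡ n₂≉0 n₂[r³-r-s]≈0)
      where
        e₀ : r * n₀ - s * n₂ ≈ 0#
        e₀ = difference-zero (sym (θn≈rn zero))
        e₁ : r * n₁ - (n₀ + n₂) ≈ 0#
        e₁ = difference-zero (sym (θn≈rn (suc zero)))
        e₂ : r * n₂ - n₁ ≈ 0#
        e₂ = difference-zero (sym (θn≈rn (suc (suc zero))))

        n₂≉0 : ¬ n₂ ≈ 0#
        n₂≉0 n₂≈0 = n≢0 (zero-by-coordinates n₀≈0 n₁≈0 n₂≈0)
          where
            n₁≈0 : n₁ ≈ 0#
            n₁≈0 = trans (θn≈rn (suc (suc zero))) (multiple-of-zero r n₂≈0)
            n₀≈0 : n₀ ≈ 0#
            n₀≈0 = begin
              n₀                    ≈⟨ solve 2 (λ a b → a := (a :+ b) :- b) refl n₀ n₂ ⟩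
              (n₀ + n₂) - n₂        ≈⟨ +-cong (θn≈rn (suc zero)) (-‿cong n₂≈0) ⟩
              r * n₁ - 0#           ≈⟨ +-cong (multiple-of-zero r n₁≈0) (-‿cong refl) ⟩
              0# - 0#               ≈⟨ -‿inverseʳ 0# ⟩
              0#                    ∎

        n₂[r³-r-s]≈0 : n₂ * (r * r * r - (r + s)) ≈ 0#
        n₂[r³-r-s]≈0 = begin
          n₂ * (r * r * r - (r + s))
            ≈⟨ solve 5 (λ r s n₀ n₁ n₂ → n₂ :* (r :* r :* r :- (r :+ s)) :=
                 r :* r :* (r :* n₂ :- n₁) :+ (r :* (r :* n₁ :- (n₀ :+ n₂)) :+ (r :* n₀ :- s :* n₂)))
               refl r s n₀ n₁ n₂ ⟩
          r * r * (r * n₂ - n₁) + (r * (r * n₁ - (n₀ + n₂)) + (r * n₀ - s * n₂))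
            ≈⟨ sum-of-zeros (multiple-of-zero _ e₂) (sum-of-zeros (multiple-of-zero _ e₁) e₀) ⟩
          0# ∎

    -- a nonzero element g₀ + g₁θ of degree ≤ 1 is not a zero divisor:
    -- for g₁ ≈ 0 this is cancellation in F; otherwise g·n = 0 makes n an
    -- eigenvector of θ with eigenvalue -g₀/g₁, which would be a root
    linear-not-zero-divisor : ∀ g n → x₂ g ≈ 0# → Nonzero g → Nonzero n → ¬ IsZero (g · n)
    linear-not-zero-divisor g n g₂≈0 g≢0 n≢0 gn≈0 with x₁ g ≈? 0#
    ... | yes g₁≈0 = n≢0 λ i → cancelˡ g₀≉0 (begin
      x₀ g * coord n i
        ≈⟨ solve 3 (λ a b c → a := (a :+ con (+ 0) :* b) :+ con (+ 0) :* c) refl _ _ _ ⟩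
      (x₀ g * coord n i + 0# * coord (θ· n) i) + 0# * coord (θ· (θ· n)) i
        ≈⟨ +-cong (+-congˡ (*-congʳ (sym g₁≈0))) (*-congʳ (sym g₂≈0)) ⟩
      (x₀ g * coord n i + x₁ g * coord (θ· n) i) + x₂ g * coord (θ· (θ· n)) i
        ≈⟨ sym (coord-· g n i) ⟩
      coord (g · n) i
        ≈⟨ gn≈0 i ⟩
      0# ∎)
      where
        g₀≉0 : ¬ x₀ g ≈ 0#
        g₀≉0 g₀≈0 = g≢0 (zero-by-coordinates g₀≈0 g₁≈0 g₂≈0)
    ... | no g₁≉0 with inverse (x₁ g) g₁≉0
    ... | h , g₁h≈1 = noRoot r (eigenvalue-is-root n≢0 θn≈rn)
      where
        r = - (x₀ g * h)
        θn≈rn : θ· n ≈₃ r ⋆ n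
        θn≈rn i = trans (equal-if-difference-zero (begin
          coord (θ· n) i - r * coord n i
            ≈⟨ solve 7 (λ g₀ g₁ g₂ h a b c →
                 b :- (:- (g₀ :* h)) :* a :=
                 h :* ((g₀ :* a :+ g₁ :* b) :+ g₂ :* c) :- (g₁ :* h :- con (+ 1)) :* b :- h :* g₂ :* c)
               refl (x₀ g) (x₁ g) (x₂ g) h (coord n i) (coord (θ· n) i) (coord (θ· (θ· n)) i) ⟩
          h * ((x₀ g * coord n i + x₁ g * coord (θ· n) i) + x₂ g * coord (θ· (θ· n)) i)
            - (x₁ g * h - 1#) * coord (θ· n) i - h * x₂ g * coord (θ· (θ· n)) i
            ≈⟨ +-cong (+-cong (multiple-of-zero h (trans (sym (coord-· g n i)) (gn≈0 i)))
                              (-‿cong (*-congʳ (difference-zero g₁h≈1))))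
                      (-‿cong (*-congʳ (multiple-of-zero h g₂≈0))) ⟩
          0# - 0# * coord (θ· n) i - 0# * coord (θ· (θ· n)) i
            ≈⟨ solve 2 (λ a b → con (+ 0) :- con (+ 0) :* a :- con (+ 0) :* b := con (+ 0)) refl _ _ ⟩
          0# ∎)) (sym (coord-⋆ r n i))

    -- For g of degree 2 multiply by
    -- the linear element lowering g = -g₁ + g₂θ: the product h has degree ≤ 1
    -- and either h = 0 (a linear zero divisor) or h·n = lowering g·(g·n) = 0.
    lowering : Triple Carrier → Triple Carrier
    lowering g = ⟨ - x₁ g , x₂ g , 0# ⟩

    lowering-lowers : ∀ g → x₂ (lowering g · g) ≈ 0#
    lowering-lowers g = solve 3 (λ g₀ g₁ g₂ → (:- g₁ :* g₂ :+ g₂ :* g₁) :+ con (+ 0) :* (g₀ :+ g₂) := con (+ 0))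
                          refl (x₀ g) (x₁ g) (x₂ g)

    no-zero-divisors : ∀ g n → Nonzero g → Nonzero n → ¬ IsZero (g · n)
    no-zero-divisors g n g≢0 n≢0 gn≈0 with x₂ g ≈? 0# | isZero? (lowering g · g)
    ... | yes g₂≈0 | _       = linear-not-zero-divisor g n g₂≈0 g≢0 n≢0 gn≈0
    ... | no g₂≉0 | yes h≈0 =
      linear-not-zero-divisor (lowering g) g refl (λ l≈0 → g₂≉0 (l≈0 (suc zero))) g≢0 h≈0
    ... | no g₂≉0 | no h≢0  =
      linear-not-zero-divisor (lowering g · g) n (lowering-lowers g) h≢0 n≢0
        (λ i → trans (·-assoc (lowering g) g n i) (·-zeroʳ (lowering g) gn≈0 i))

    zero-divisor-is-zero : ∀ {g n} → Nonzero n → IsZero (g · n) → IsZero g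
    zero-divisor-is-zero {g} {n} n≢0 gn≈0 with isZero? g
    ... | yes g≈0 = g≈0
    ... | no g≢0  = ⊥-elim (no-zero-divisors g n g≢0 n≢0 gn≈0)

    -- A linear rank-distance code: the matrices (X | Y | θX + θ²Y).

    columns : Triple Carrier → Triple Carrier → Matrix
    columns X Y zero             = X
    columns X Y (suc zero)       = Y
    columns X Y (suc (suc zero)) = thirdColumn X Y

    thirdColumn-cong : ∀ {X X' Y Y'} → X ≈₃ X' → Y ≈₃ Y' → thirdColumn X Y ≈₃ thirdColumn X' Y'
    thirdColumn-cong X≈X' Y≈Y' = +₃-cong (θ·-cong X≈X') (θ·-cong (θ·-cong Y≈Y'))

    thirdColumn-of-multiples : ∀ α β γ n → ⟨ - γ , α , β ⟩ · n ≈₃ thirdColumn (α ⋆ n) (β ⋆ n) -₃ γ ⋆ n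
    thirdColumn-of-multiples α β γ ⟨ n₀ , n₁ , n₂ ⟩ = coordinatewise
      (solve 7 (λ α β γ n₀ n₁ n₂ S → let open Cubicᴱ S; N = ⟨ n₀ , n₁ , n₂ ⟩ in
        x₀ (⟨ :- γ , α , β ⟩ ·ᴱ N) := x₀ (thirdColumnᴱ (α ⋆ᴱ N) (β ⋆ᴱ N) -ᴱ γ ⋆ᴱ N)) refl α β γ n₀ n₁ n₂ s)
      (solve 7 (λ α β γ n₀ n₁ n₂ S → let open Cubicᴱ S; N = ⟨ n₀ , n₁ , n₂ ⟩ in
        x₁ (⟨ :- γ , α , β ⟩ ·ᴱ N) := x₁ (thirdColumnᴱ (α ⋆ᴱ N) (β ⋆ᴱ N) -ᴱ γ ⋆ᴱ N)) refl α β γ n₀ n₁ n₂ s)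
      (solve 7 (λ α β γ n₀ n₁ n₂ S → let open Cubicᴱ S; N = ⟨ n₀ , n₁ , n₂ ⟩ in
        x₂ (⟨ :- γ , α , β ⟩ ·ᴱ N) := x₂ (thirdColumnᴱ (α ⋆ᴱ N) (β ⋆ᴱ N) -ᴱ γ ⋆ᴱ N)) refl α β γ n₀ n₁ n₂ s)

    rank-at-least-two : ∀ X Y → ¬ (IsZero X × IsZero Y) → RankAtLeastTwo (columns X Y)
    rank-at-least-two X Y XY≢0 n n≢0 multiples
      with multiples zero | multiples (suc zero) | multiples (suc (suc zero))
    ... | α , X≈αn | β , Y≈βn | γ , Z≈γn = XY≢0 (vanishes X≈αn α≈0 , vanishes Y≈βn β≈0)
      where
        g≈0 : IsZero ⟨ - γ , α , β ⟩
        g≈0 = zero-divisor-is-zero n≢0 λ i → begin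
          coord (⟨ - γ , α , β ⟩ · n) i                           ≈⟨ thirdColumn-of-multiples α β γ n i ⟩
          coord (thirdColumn (α ⋆ n) (β ⋆ n) -₃ γ ⋆ n) i          ≈⟨ coord-₃ _ _ i ⟩
          coord (thirdColumn (α ⋆ n) (β ⋆ n)) i - coord (γ ⋆ n) i ≈⟨ +-congʳ (thirdColumn-cong X≈αn Y≈βn i) ⟨
          coord (thirdColumn X Y) i - coord (γ ⋆ n) i             ≈⟨ difference-zero (Z≈γn i) ⟩
          0#                                                      ∎
        α≈0 : α ≈ 0#
        α≈0 = g≈0 (suc zero)
        β≈0 : β ≈ 0#
        β≈0 = g≈0 (suc (suc zero))
        vanishes : ∀ {u k} → u ≈₃ k ⋆ n → k ≈ 0# → IsZero u
        vanishes u≈kn k≈0 i = trans (u≈kn i) (trans (coord-⋆ _ n i) (trans (*-congʳ k≈0) (zeroˡ _)))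

    columns-linear : ∀ X Y X' Y' j → columns X Y j -₃ columns X' Y' j ≈₃ columns (X -₃ X') (Y -₃ Y') j
    columns-linear X Y X' Y' zero             i = refl
    columns-linear X Y X' Y' (suc zero)       i = refl
    columns-linear ⟨ a₀ , a₁ , a₂ ⟩ ⟨ b₀ , b₁ , b₂ ⟩ ⟨ c₀ , c₁ , c₂ ⟩ ⟨ d₀ , d₁ , d₂ ⟩ (suc (suc zero)) =
      coordinatewise
      (solve 13 (λ a₀ a₁ a₂ b₀ b₁ b₂ c₀ c₁ c₂ d₀ d₁ d₂ S →
         let open Cubicᴱ S
             X = ⟨ a₀ , a₁ , a₂ ⟩; Y = ⟨ b₀ , b₁ , b₂ ⟩
             X' = ⟨ c₀ , c₁ , c₂ ⟩; Y' = ⟨ d₀ , d₁ , d₂ ⟩ in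
         x₀ (thirdColumnᴱ X Y -ᴱ thirdColumnᴱ X' Y') := x₀ (thirdColumnᴱ (X -ᴱ X') (Y -ᴱ Y')))
        refl a₀ a₁ a₂ b₀ b₁ b₂ c₀ c₁ c₂ d₀ d₁ d₂ s)
      (solve 13 (λ a₀ a₁ a₂ b₀ b₁ b₂ c₀ c₁ c₂ d₀ d₁ d₂ S →
         let open Cubicᴱ S
             X = ⟨ a₀ , a₁ , a₂ ⟩; Y = ⟨ b₀ , b₁ , b₂ ⟩
             X' = ⟨ c₀ , c₁ , c₂ ⟩; Y' = ⟨ d₀ , d₁ , d₂ ⟩ in
         x₁ (thirdColumnᴱ X Y -ᴱ thirdColumnᴱ X' Y') := x₁ (thirdColumnᴱ (X -ᴱ X') (Y -ᴱ Y')))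
        refl a₀ a₁ a₂ b₀ b₁ b₂ c₀ c₁ c₂ d₀ d₁ d₂ s)
      (solve 13 (λ a₀ a₁ a₂ b₀ b₁ b₂ c₀ c₁ c₂ d₀ d₁ d₂ S →
         let open Cubicᴱ S
             X = ⟨ a₀ , a₁ , a₂ ⟩; Y = ⟨ b₀ , b₁ , b₂ ⟩
             X' = ⟨ c₀ , c₁ , c₂ ⟩; Y' = ⟨ d₀ , d₁ , d₂ ⟩ in
         x₂ (thirdColumnᴱ X Y -ᴱ thirdColumnᴱ X' Y') := x₂ (thirdColumnᴱ (X -ᴱ X') (Y -ᴱ Y')))
        refl a₀ a₁ a₂ b₀ b₁ b₂ c₀ c₁ c₂ d₀ d₁ d₂ s)

    rank-distance-two : ∀ X Y X' Y' → ¬ (IsZero (X -₃ X') × IsZero (Y -₃ Y')) →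
      RankAtLeastTwo (λ j → columns X Y j -₃ columns X' Y' j)
    rank-distance-two X Y X' Y' distinct =
      rank-resp-≈₃ (columns-linear X Y X' Y') (rank-at-least-two (X -₃ X') (Y -₃ Y') distinct)

    -- The lifted code: pairwise intersections have dimension at most one.

    codeword : Triple Carrier → Triple Carrier → Subspace 6 3
    codeword X Y = lift (columns X Y)

    codewords-meet-in-dim-one : ∀ X Y X' Y' → ¬ (IsZero (X -₃ X') × IsZero (Y -₃ Y')) →
      IntersectionDimAtMost 1 (codeword X Y) (codeword X' Y')
    codewords-meet-in-dim-one X Y X' Y' distinct =
      lifted-intersection (columns X Y) (columns X' Y') (rank-distance-two X Y X' Y' distinct)

  -- m three-dimensional subspaces of F⁶, pairwise different and pairwise
  -- meeting in dimension at most one: a (6, m, 4; 3) constant dimension code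
  ConstantDimensionCode : ℕ → Set (c Level.⊔ ℓ)
  ConstantDimensionCode m =
    Σ[ C ∈ (Fin m → Subspace 6 3) ]
      ((∀ i j → i ≢ j → ¬ SameSubspace (C i) (C j)) × (∀ i j → i ≢ j → IntersectionDimAtMost 1 (C i) (C j)))

  code-from-small-intersections : ∀ {m} (C : Fin m → Subspace 6 3) →
    (∀ i j → i ≢ j → IntersectionDimAtMost 1 (C i) (C j)) → ConstantDimensionCode m
  code-from-small-intersections C small =
    C , (λ i j i≢j → distinct-if-small-intersection (C i) (C j) (small i j i≢j)) , small

-- Counting on finite sets.

-- an injective self-map of a finite set is onto (otherwise it would
-- squeeze Fin (suc m) injectively into Fin m)
injective-endo-onto : ∀ {n} (φ : Fin n → Fin n) → Injective _≡_ _≡_ φ → ∀ c → ∃[ i ] φ i ≡ c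
injective-endo-onto {suc m} φ φ-injective c with FinP.any? (λ i → φ i ≟ c)
... | yes hit = hit
... | no miss = ⊥-elim (ℕP.n≮n m (FinP.injective⇒≤ squeezed-injective))
  where
    avoids : ∀ i → c ≢ φ i
    avoids i c≡φi = miss (i , ≡.sym c≡φi)
    squeezed : Fin (suc m) → Fin m
    squeezed i = punchOut (avoids i)
    squeezed-injective : Injective _≡_ _≡_ squeezed
    squeezed-injective e = φ-injective (FinP.punchOut-injective (avoids _) (avoids _) e)

-- a self-map of a finite set that is onto is injective: a section of it
-- is injective, hence onto, and ψ is inverse to that section
onto-endo-injective : ∀ {n} (ψ : Fin n → Fin n) → (∀ j → ∃[ i ] ψ i ≡ j) → Injective _≡_ _≡_ ψ
onto-endo-injective {n} ψ onto {a} {b} ψa≡ψb = begin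
  a                    ≡⟨ preimage a ⟨
  section (index a)    ≡⟨ ≡.cong section same-index ⟩
  section (index b)    ≡⟨ preimage b ⟩
  b                    ∎
  where
    open ≡.≡-Reasoning
    section : Fin n → Fin n
    section j = proj₁ (onto j)
    ψ∘section : ∀ j → ψ (section j) ≡ j
    ψ∘section j = proj₂ (onto j)
    section-injective : Injective _≡_ _≡_ section
    section-injective {j} {j'} e = ≡.trans (≡.sym (ψ∘section j)) (≡.trans (≡.cong ψ e) (ψ∘section j'))
    index : Fin n → Fin n
    index x = proj₁ (injective-endo-onto section section-injective x)
    preimage : ∀ x → section (index x) ≡ x
    preimage x = proj₂ (injective-endo-onto section section-injective x)
    same-index : index a ≡ index b
    same-index = begin
      index a                ≡⟨ ψ∘section (index a) ⟨
      ψ (section (index a))  ≡⟨ ≡.cong ψ (preimage a) ⟩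
      ψ a                    ≡⟨ ψa≡ψb ⟩
      ψ b                    ≡⟨ ≡.cong ψ (preimage b) ⟨
      ψ (section (index b))  ≡⟨ ψ∘section (index b) ⟩
      index b                ∎

collision⇒misses : ∀ {n} (ψ : Fin n → Fin n) {a b} → a ≢ b → ψ a ≡ ψ b → ∃[ j ] ∀ i → ψ i ≢ j
collision⇒misses {n} ψ a≢b ψa≡ψb with FinP.all? (λ j → FinP.any? (λ i → ψ i ≟ j))
... | yes onto    = ⊥-elim (a≢b (onto-endo-injective ψ onto ψa≡ψb))
... | no not-onto with FinP.¬∀⟶∃¬ n _ (λ j → FinP.any? (λ i → ψ i ≟ j)) not-onto
...   | j , missed = j , λ i ψi≡j → missed (i , ψi≡j)

funToFin-cong : ∀ {m n} {f g : Fin m → Fin n} → (∀ k → f k ≡ g k) → funToFin f ≡ funToFin g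
funToFin-cong {zero}  f≗g = ≡.refl
funToFin-cong {suc m} f≗g = ≡.cong₂ combine (f≗g zero) (funToFin-cong (λ k → f≗g (suc k)))

finToFun-injective : ∀ {m n} {i j : Fin (m Nat.^ n)} →
  (∀ k → finToFun {m} {n} i k ≡ finToFun j k) → i ≡ j
finToFun-injective {m} {n} {i} {j} same-digits = begin
  i                              ≡⟨ FinP.funToFin-finToFin {n} {m} i ⟨
  funToFin (finToFun {m} {n} i)  ≡⟨ funToFin-cong {n} {m} same-digits ⟩
  funToFin (finToFun {m} {n} j)  ≡⟨ FinP.funToFin-finToFin {n} {m} j ⟩
  j                              ∎
  where open ≡.≡-Reasoning

-- The number of codewords needed is at most q⁶ (for q ≥ 2).

module SizeBound where
  open Nat using (_+_; _*_; _^_; _∸_; _≤_; _/_)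
  open import Data.Nat.DivMod using (m/n*n≤m)
  open import Data.Nat.Solver using (module +-*-Solver)
  open +-*-Solver using (solve; _:=_; _:+_; _:*_; _:^_; con)

  -- 3q⁶ - q³(q² - 1)(q - 1) - 3(q² + 1)(q² + q + 1) for q = 2 + k, a polynomial
  -- in k with nonnegative coefficients
  slack : ℕ → ℕ
  slack k = 63 + 325 * k + 482 * k ^ 2 + 340 * k ^ 3 + 128 * k ^ 4 + 25 * k ^ 5 + 2 * k ^ 6

  q²-1 : ∀ k → (2 + k) ^ 2 ≡ 1 + (1 + k) * (3 + k)
  q²-1 = solve 1 (λ k → (con 2 :+ k) :^ 2 := con 1 :+ (con 1 :+ k) :* (con 3 :+ k)) ≡.refl

  size-identity : ∀ k → (2 + k) ^ 3 * ((1 + k) * (3 + k)) * (1 + k)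
                        + 3 * (((2 + k) ^ 2 + 1) * ((2 + k) ^ 2 + (2 + k) + 1)) + slack k
                        ≡ 3 * (2 + k) ^ 6
  size-identity = solve 1 (λ k → let q = con 2 :+ k in
    q :^ 3 :* ((con 1 :+ k) :* (con 3 :+ k)) :* (con 1 :+ k)
      :+ con 3 :* ((q :^ 2 :+ con 1) :* (q :^ 2 :+ q :+ con 1))
      :+ (con 63 :+ con 325 :* k :+ con 482 :* k :^ 2 :+ con 340 :* k :^ 3 :+ con 128 :* k :^ 4
          :+ con 25 :* k :^ 5 :+ con 2 :* k :^ 6)
    := con 3 :* q :^ 6) ≡.refl

  -- 3·codeSize q ≤ q³(q²-1)(q-1) + 3(q²+1)(q²+q+1) ≤ 3q⁶
  codeSize≤q⁶ : ∀ k → codeSize (2 + k) ≤ (2 + k) ^ 6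
  codeSize≤q⁶ k = ℕP.*-cancelˡ-≤ 3 (begin
    3 * (m / 3 + S)           ≡⟨ ℕP.*-distribˡ-+ 3 (m / 3) S ⟩
    3 * (m / 3) + 3 * S       ≤⟨ ℕP.+-monoˡ-≤ (3 * S) (≡.subst (_≤ m) (ℕP.*-comm (m / 3) 3) (m/n*n≤m m 3)) ⟩
    m + 3 * S                 ≤⟨ ℕP.m≤m+n (m + 3 * S) (slack k) ⟩
    m + 3 * S + slack k       ≡⟨ ≡.cong (λ t → q ^ 3 * t * (1 + k) + 3 * S + slack k) (≡.cong (_∸ 1) (q²-1 k)) ⟩
    q ^ 3 * ((1 + k) * (3 + k)) * (1 + k) + 3 * S + slack k ≡⟨ size-identity k ⟩
    3 * q ^ 6                 ∎)
    where
      open ℕP.≤-Reasoning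
      q = 2 + k
      m = q ^ 3 * (q ^ 2 ∸ 1) * (q ∸ 1)
      S = (q ^ 2 + 1) * (q ^ 2 + q + 1)

-- A field with q elements.

module FiniteField {c ℓ : Level} (F : CommutativeRing c ℓ) (isField : IsField F) {q : ℕ}
  (size : HasSize F q) where

  open CommutativeRing F hiding (zero)
  open IsField isField
  open HasSize size
  import Relation.Nullary.Decidable as Dec

  _≈?_ : ∀ x y → Dec (x ≈ y)
  x ≈? y = Dec.map′ toFin-inj toFin-cong (toFin x ≟ toFin y)

  open OverAField F isField _≈?_
  open IntegerCoefficients F
  open LinAlg F using (Subspace)

  fromFin-injective : ∀ {a b} → fromFin a ≈ fromFin b → a ≡ b
  fromFin-injective {a} {b} e = ≡.trans (≡.sym (toFin-from a)) (≡.trans (toFin-cong e) (toFin-from b))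

  at-least-two-elements : ∃[ k ] q ≡ 2 Nat.+ k
  at-least-two-elements = helper (toFin 0#) (toFin 1#) (λ e → 0≉1 (toFin-inj e))
    where
      helper : ∀ {n} (a b : Fin n) → a ≢ b → ∃[ k ] n ≡ 2 Nat.+ k
      helper {suc (suc k)} _    _    _   = k , ≡.refl
      helper {suc zero}    zero zero a≢b = ⊥-elim (a≢b ≡.refl)

  from-to : ∀ x → fromFin (toFin x) ≈ x
  from-to x = toFin-inj (toFin-from (toFin x))

  r³-r : Carrier → Carrier
  r³-r r = r * r * r - r

  r³-r-cong : ∀ {x y} → x ≈ y → r³-r x ≈ r³-r y
  r³-r-cong e = +-cong (*-cong (*-cong e e) e) (-‿cong e)

  ψ : Fin q → Fin q
  ψ i = toFin (r³-r (fromFin i))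

  -- both 0 and 1 are roots of r³ - r
  ψ0≡ψ1 : ψ (toFin 0#) ≡ ψ (toFin 1#)
  ψ0≡ψ1 = toFin-cong (begin
    r³-r (fromFin (toFin 0#))   ≈⟨ r³-r-cong (from-to 0#) ⟩
    r³-r 0#                     ≈⟨ solve 0 (con (+ 0) :* con (+ 0) :* con (+ 0) :- con (+ 0) := con (+ 0)) refl ⟩
    0#                          ≈⟨ solve 0 (con (+ 0) := con (+ 1) :* con (+ 1) :* con (+ 1) :- con (+ 1)) refl ⟩
    r³-r 1#                     ≈⟨ r³-r-cong (from-to 1#) ⟨
    r³-r (fromFin (toFin 1#))   ∎)
    where open import Relation.Binary.Reasoning.Setoid setoid

  -- r ↦ r³ - r identifies 0 and 1, so it misses some s: then θ³ - θ - s
  -- has no root in F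
  cubic-without-root : ∃[ s ] ∀ r → ¬ (r * r * r ≈ r + s)
  cubic-without-root with collision⇒misses ψ (λ e → 0≉1 (toFin-inj e)) ψ0≡ψ1
  ... | j , missed = fromFin j , λ r root → missed (toFin r) (begin
    ψ (toFin r)                         ≡⟨ toFin-cong (r³-r-cong (from-to r)) ⟩
    toFin (r³-r r)                      ≡⟨ toFin-cong (trans (+-congʳ root) (r+s-r≈s r (fromFin j))) ⟩
    toFin (fromFin j)                   ≡⟨ toFin-from j ⟩
    j                                   ∎)
    where
      open ≡.≡-Reasoning
      r+s-r≈s : ∀ r s → (r + s) - r ≈ s
      r+s-r≈s = solve 2 (λ r s → (r :+ s) :- r := s) refl

  -- the six base-q digits of an index, read as two triples of field elements
  digit : Fin (q Nat.^ 6) → Fin 6 → Carrier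
  digit i k = fromFin (finToFun i k)

  firstTriple secondTriple : Fin (q Nat.^ 6) → Triple Carrier
  firstTriple  i = ⟨ digit i zero , digit i (suc zero) , digit i (suc (suc zero)) ⟩
  secondTriple i = ⟨ digit i (suc (suc (suc zero))) , digit i (suc (suc (suc (suc zero))))
                   , digit i (suc (suc (suc (suc (suc zero))))) ⟩

  triples-distinct : ∀ {i j} → i ≢ j →
    ¬ (IsZero (firstTriple i -₃ firstTriple j) × IsZero (secondTriple i -₃ secondTriple j))
  triples-distinct {i} {j} i≢j (X≈X' , Y≈Y') = i≢j (finToFun-injective {q} {6} same-digits)
    where
      same : ∀ {a b} → fromFin a - fromFin b ≈ 0# → a ≡ b
      same d = fromFin-injective (equal-if-difference-zero d)
      same-digits : ∀ k → finToFun i k ≡ finToFun j k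
      same-digits zero                                = same (X≈X' zero)
      same-digits (suc zero)                          = same (X≈X' (suc zero))
      same-digits (suc (suc zero))                    = same (X≈X' (suc (suc zero)))
      same-digits (suc (suc (suc zero)))              = same (Y≈Y' zero)
      same-digits (suc (suc (suc (suc zero))))        = same (Y≈Y' (suc zero))
      same-digits (suc (suc (suc (suc (suc zero)))))  = same (Y≈Y' (suc (suc zero)))

  lifted-code : ∀ {m} → m Nat.≤ q Nat.^ 6 → ConstantDimensionCode m
  lifted-code {m} m≤q⁶ = code-from-small-intersections C small-intersections
    where
      open CubicField (proj₁ cubic-without-root) (proj₂ cubic-without-root)
      index : Fin m → Fin (q Nat.^ 6)
      index i = inject≤ i m≤q⁶
      C : Fin m → Subspace 6 3
      C i = codeword (firstTriple (index i)) (secondTriple (index i))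
      small-intersections : ∀ i j → i ≢ j → LinAlg.IntersectionDimAtMost F 1 (C i) (C j)
      small-intersections i j i≢j =
        codewords-meet-in-dim-one (firstTriple (index i)) (secondTriple (index i))
                                  (firstTriple (index j)) (secondTriple (index j))
                                  (triples-distinct {index i} {index j} index-distinct)
        where
          index-distinct : index i ≢ index j
          index-distinct e = i≢j (FinP.inject≤-injective _ _ i j e)

corollary7p4 : {c ℓ : Level} (q : ℕ) → IsPrimePower q →
               (F : CommutativeRing c ℓ) → IsField F → HasSize F q →
               Σ[ C ∈ (Fin (codeSize q) → LinAlg.Subspace F 6 3) ]
                 ((∀ i j → i ≢ j → ¬ LinAlg.SameSubspace F (C i) (C j))
                 × (∀ i j → i ≢ j → LinAlg.IntersectionDimAtMost F 1 (C i) (C j)))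
corollary7p4 q _ F isField size with FiniteField.at-least-two-elements F isField size
... | k , ≡.refl = FiniteField.lifted-code F isField size (SizeBound.codeSize≤q⁶ k)
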